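{- For every $n\ge1$, every $1$-almost-increasing permutation $\pi\in S_n$ can be written uniquely as $\pi=\rho^{(1)}\circ\rho^{(2)}\circ\cdots\circ\rho^{(n)}(e_0)$ where each $\rho^{(m)}\in\{\rho_{1,1},\rho_{1,2},\rho_{2,1},\rho_{2,2}\}$, $\rho^{(n)}=\rho_{1,1}$, and there is no index $m$ with $(\rho^{(m)},\rho^{(m+1)})=(\rho_{2,1},\rho_{1,1})$ or $(\rho^{(m)},\rho^{(m+1)})=(\rho_{2,2},\rho_{1,1})$.
   Context: $S_0$ consists of the empty permutation $e_0$. A permutation is $1$-almost-increasing if it avoids each of the patterns $4321, 4312, 3421, 3412$ (no subsequence of its one-line form has the same relative order as one of them). For $\pi\in S_m$ and $1\le i,j\le m+1$, $\rho_{i,j}(\pi)\in S_{m+1}$ is obtained by increasing by $1$ every entry of $\pi$ that is $\ge i$ and then inserting the value $i$ so that it occupies position $j$; in particular $\rho_{1,1}(e_0)=[1]$. -}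

module Defs where

open import Data.Nat using (ℕ; zero; suc; _<_; _≤ᵇ_; _∸_)
open import Data.Bool using (if_then_else_)
open import Data.List using (List; []; _∷_; map; upTo; take; drop; _++_; length; last)
open import Data.Maybe using (just)
open import Data.Vec using (Vec; lookup; toList) renaming ([] to []ᵥ; _∷_ to _∷ᵥ_)
open import Data.Fin using (Fin)
open import Data.Product using (Σ; ∃; _×_)
open import Function.Bundles using (_⇔_)
open import Relation.Nullary using (¬_)
open import Relation.Binary.PropositionalEquality using (_≡_)
open import Data.List.Relation.Binary.Permutation.Propositional using (_↭_)
open import Data.List.Relation.Binary.Sublist.Propositional using (_⊆_)

-- Permutations in one-line notation: lists of natural numbers.
-- π ∈ S_n  iff  π is a rearrangement of [1, 2, ..., n].
IsPerm : ℕ → List ℕ → Set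
IsPerm n π = π ↭ map suc (upTo n)

OrderIso : ∀ {k} → Vec ℕ k → Vec ℕ k → Set
OrderIso σ p = ∀ a b → (lookup σ a < lookup σ b) ⇔ (lookup p a < lookup p b)

Contains : ∀ {k} → List ℕ → Vec ℕ k → Set
Contains {k} π p = Σ (Vec ℕ k) (λ σ → (toList σ ⊆ π) × OrderIso σ p)

p4321 p4312 p3421 p3412 : Vec ℕ 4
p4321 = 4 ∷ᵥ 3 ∷ᵥ 2 ∷ᵥ 1 ∷ᵥ []ᵥ
p4312 = 4 ∷ᵥ 3 ∷ᵥ 1 ∷ᵥ 2 ∷ᵥ []ᵥ
p3421 = 3 ∷ᵥ 4 ∷ᵥ 2 ∷ᵥ 1 ∷ᵥ []ᵥ
p3412 = 3 ∷ᵥ 4 ∷ᵥ 1 ∷ᵥ 2 ∷ᵥ []ᵥ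

AlmostIncreasing1 : List ℕ → Set
AlmostIncreasing1 π =
  ¬ Contains π p4321 × ¬ Contains π p4312 × ¬ Contains π p3421 × ¬ Contains π p3412

-- ρ_{i,j}: increase every entry ≥ i by 1, then insert value i at (1-based) position j.
bump : ℕ → ℕ → ℕ
bump i x = if i ≤ᵇ x then suc x else x

ρ : ℕ → ℕ → List ℕ → List ℕ
ρ i j π = take (j ∸ 1) π' ++ (i ∷ drop (j ∸ 1) π')
  where π' = map (bump i) π

data Op : Set where
  r11 r12 r21 r22 : Op

apply : Op → List ℕ → List ℕ
apply r11 = ρ 1 1
apply r12 = ρ 1 2
apply r21 = ρ 2 1
apply r22 = ρ 2 2

-- [ρ⁽¹⁾, …, ρ⁽ⁿ⁾]  ↦  ρ⁽¹⁾ ∘ ρ⁽²⁾ ∘ ⋯ ∘ ρ⁽ⁿ⁾ (e₀), with e₀ the empty permutation.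
compose : List Op → List ℕ
compose [] = []
compose (o ∷ os) = apply o (compose os)

data NoBadPair : List Op → Set where
  nb-nil  : NoBadPair []
  nb-one  : ∀ o → NoBadPair (o ∷ [])
  nb-cons : ∀ o o' os → ¬ (o ≡ r21 × o' ≡ r11) → ¬ (o ≡ r22 × o' ≡ r11)
          → NoBadPair (o' ∷ os) → NoBadPair (o ∷ o' ∷ os)

Admissible : ℕ → List Op → Set
Admissible n os = (length os ≡ n) × (last os ≡ just r11) × NoBadPair os

-- Uniqueness: the leading operator of an admissible word can be read off the first two
-- entries of the permutation it produces (1 first: ρ₁₁, 1 second: ρ₁₂, 2 first: ρ₂₁,
-- otherwise ρ₂₂); the forbidden pairs ρ₂₁ρ₁₁ and ρ₂₂ρ₁₁ are exactly the ones that would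
-- make ρ₂₁ look like ρ₁₂ and ρ₂₂ like ρ₁₁. Since every ρ_{i,j} is injective, induction
-- on the word finishes the argument.
--
-- Existence: in a 1-almost-increasing permutation the value 1 or 2 occupies one of the
-- first two positions, for otherwise the first two entries together with 1 and 2 form
-- one of 3412, 3421, 4312, 4321. Deleting that value and standardising gives a smaller
-- permutation, still 1-almost-increasing because ρ_{i,j} preserves every pattern. When
-- the deleted value is 2, the value 1 is not among the first two entries, so the smaller
-- permutation does not start with 1 and no forbidden pair arises.

module Submission where

open import Defs
open import Data.Nat using (ℕ; zero; suc; pred; _+_; _∸_; _≤_; _<_; _<ᵇ_; z≤n; s≤s; _≟_)
open import Data.Nat.Properties
  using (<-cmp; <-irrefl; <-asym; <-trans; n<1+n; n≮0; m<1+n⇒m<n∨m≡n; suc-injective)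
open import Data.Bool.Properties using (if-float)
open import Data.List using (List; []; _∷_; map; upTo; take; drop; _++_; last)
open import Data.List.Properties
  using (∷-injectiveˡ; ∷-injectiveʳ; map-∘; map-cong; map-id; map-id-local; map-injective;
         map-applyUpTo; take++drop≡id; ++-conicalʳ)
open import Data.List.Membership.Propositional using (_∈_)
open import Data.List.Membership.Propositional.Properties using (∈-map⁻)
open import Data.List.Relation.Unary.Any using (here; there)
open import Data.List.Relation.Unary.All as All using (All)
import Data.List.Relation.Unary.All.Properties as All
open import Data.List.Relation.Unary.Unique.Propositional using (Unique)
import Data.List.Relation.Unary.Unique.Propositional.Properties as Unique
open import Data.List.Relation.Binary.Sublist.Propositional
  using (_⊆_; _∷_; _∷ʳ_; ⊆-refl; ⊆-trans; from∈)
import Data.List.Relation.Binary.Sublist.Propositional.Properties as Sublist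
open import Data.List.Relation.Binary.Permutation.Propositional
  using (_↭_; ↭-refl; ↭-sym; ↭-trans; ↭-prep; ↭-swap; ↭-reflexive; ↭⇒↭ₛ; module PermutationReasoning)
open import Data.List.Relation.Binary.Permutation.Propositional.Properties
  using (shift; drop-∷; All-resp-↭; ∈-resp-↭; ↭-singleton-inv; ↭-length)
  renaming (map⁺ to ↭-map⁺)
import Data.List.Relation.Binary.Permutation.Setoid.Properties as Permutationₛ
open import Data.Vec as Vec using (Vec; toList)
open import Data.Vec.Properties using (lookup-map; toList-map)
open import Data.Maybe using (just)
open import Data.Product using (Σ; ∃!; _×_; _,_)
open import Data.Sum as Sum using (_⊎_; inj₁; inj₂)
open import Data.Empty using (⊥; ⊥-elim)
open import Function using (_∘_; _⇔_; mk⇔)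
import Function.Properties.Equivalence as ⇔
open import Relation.Binary.Core using (_Preserves_⟶_)
open import Relation.Binary.Definitions using (tri<; tri≈; tri>)
open import Relation.Binary.PropositionalEquality
open import Relation.Nullary using (¬_; yes; no)

bump-suc : ∀ i x → bump (suc i) (suc x) ≡ suc (bump i x)
bump-suc zero    x = refl
bump-suc (suc i) x = sym (if-float suc (i <ᵇ x))

bump-≢ : ∀ i x → bump i x ≢ i
bump-≢ zero    x       ()
bump-≢ (suc i) zero    ()
bump-≢ (suc i) (suc x) e = bump-≢ i x (suc-injective (trans (sym (bump-suc i x)) e))

bump-monotone : ∀ i → bump i Preserves _<_ ⟶ _<_
bump-monotone zero    x<y = s≤s x<y
bump-monotone (suc i) {zero}  {suc y} _ rewrite bump-suc i y = s≤s z≤n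
bump-monotone (suc i) {suc x} {suc y} (s≤s x<y)
  rewrite bump-suc i x | bump-suc i y = s≤s (bump-monotone i x<y)

-- Inverse of bump i on the values other than i; unbump i i = i.
unbump : ℕ → ℕ → ℕ
unbump zero    x       = pred x
unbump (suc i) zero    = zero
unbump (suc i) (suc x) = suc (unbump i x)

unbump-bump : ∀ i x → unbump i (bump i x) ≡ x
unbump-bump zero    x       = refl
unbump-bump (suc i) zero    = refl
unbump-bump (suc i) (suc x) rewrite bump-suc i x = cong suc (unbump-bump i x)

bump-unbump : ∀ i x → x ≢ i → bump i (unbump i x) ≡ x
bump-unbump zero    zero    x≢i = ⊥-elim (x≢i refl)
bump-unbump zero    (suc x) _   = refl
bump-unbump (suc i) zero    _   = refl
bump-unbump (suc i) (suc x) x≢i =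
  trans (bump-suc i (unbump i x)) (cong suc (bump-unbump i x (x≢i ∘ cong suc)))

unbump-fixes-< : ∀ i x {y} → unbump i x ≡ y → y < i → x ≡ y
unbump-fixes-< zero    x       _    y<0       = ⊥-elim (n≮0 y<0)
unbump-fixes-< (suc i) zero    refl _         = refl
unbump-fixes-< (suc i) (suc x) refl (s≤s y<i) = cong suc (unbump-fixes-< i x refl y<i)

bump-injective : ∀ i {x y} → bump i x ≡ bump i y → x ≡ y
bump-injective i {x} {y} e =
  trans (sym (unbump-bump i x)) (trans (cong (unbump i) e) (unbump-bump i y))

map-bump-suc : ∀ i xs → map (bump (suc i)) (map suc xs) ≡ map suc (map (bump i) xs)
map-bump-suc i xs = begin
  map (bump (suc i)) (map suc xs) ≡⟨ map-∘ xs ⟨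
  map (bump (suc i) ∘ suc) xs     ≡⟨ map-cong (bump-suc i) xs ⟩
  map (suc ∘ bump i) xs           ≡⟨ map-∘ xs ⟩
  map suc (map (bump i) xs)       ∎
  where open ≡-Reasoning

unbump-↭ : ∀ i {L xs} → L ↭ map (bump i) xs → map (unbump i) L ↭ xs
unbump-↭ i {L} {xs} L↭ = ↭-trans (↭-map⁺ (unbump i) L↭) (↭-reflexive (begin
  map (unbump i) (map (bump i) xs) ≡⟨ map-∘ xs ⟨
  map (unbump i ∘ bump i) xs       ≡⟨ map-cong (unbump-bump i) xs ⟩
  map (λ x → x) xs                 ≡⟨ map-id xs ⟩
  xs                               ∎))
  where open ≡-Reasoning

↭-map-bump⇒≢ : ∀ i {L} xs → L ↭ map (bump i) xs → All (_≢ i) L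
↭-map-bump⇒≢ i xs L↭ = All-resp-↭ (↭-sym L↭) (All.map⁺ (All.universal (bump-≢ i) xs))

oneTo : ℕ → List ℕ
oneTo n = map suc (upTo n)

oneTo-suc : ∀ m → oneTo (suc m) ≡ 1 ∷ map suc (oneTo m)
oneTo-suc m = cong (λ xs → 1 ∷ map suc xs) (sym (map-applyUpTo (λ i → i) suc m))

oneTo-↭-bump : ∀ m {i} → 1 ≤ i → i ≤ suc m → oneTo (suc m) ↭ i ∷ map (bump i) (oneTo m)
oneTo-↭-bump m       {1}         _ _ =
  ↭-reflexive (trans (oneTo-suc m) (cong (1 ∷_) (sym (map-bump-suc 0 (upTo m)))))
oneTo-↭-bump (suc m) {suc (suc i)} _ (s≤s i≤1+m) = begin
  oneTo (2 + m)                                       ≡⟨ oneTo-suc (suc m) ⟩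
  1 ∷ map suc (oneTo (suc m))                         ↭⟨ ↭-prep 1 (↭-map⁺ suc rest↭) ⟩
  1 ∷ 2 + i ∷ map suc (map (bump (suc i)) (oneTo m))  ↭⟨ ↭-swap 1 (2 + i) ↭-refl ⟩
  2 + i ∷ 1 ∷ map suc (map (bump (suc i)) (oneTo m))  ≡⟨ cong (2 + i ∷_) bumped ⟨
  2 + i ∷ map (bump (2 + i)) (oneTo (suc m))          ∎
  where
  open PermutationReasoning
  rest↭ : oneTo (suc m) ↭ suc i ∷ map (bump (suc i)) (oneTo m)
  rest↭ = oneTo-↭-bump m (s≤s z≤n) i≤1+m
  bumped : map (bump (2 + i)) (oneTo (suc m)) ≡ 1 ∷ map suc (map (bump (suc i)) (oneTo m))
  bumped = trans (cong (map (bump (2 + i))) (oneTo-suc m)) (cong (1 ∷_) (map-bump-suc (suc i) (oneTo m)))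

∈-oneTo⇒positive : ∀ {x n} → x ∈ oneTo n → 0 < x
∈-oneTo⇒positive x∈ with ∈-map⁻ suc x∈
... | _ , _ , refl = s≤s z≤n

Unique-oneTo : ∀ n → Unique (oneTo n)
Unique-oneTo n = Unique.map⁺ suc-injective (Unique.upTo⁺ n)

putAt : ∀ {A : Set} → ℕ → A → List A → List A
putAt k x xs = take k xs ++ x ∷ drop k xs

putAt-↭ : ∀ {A : Set} k (x : A) xs → putAt k x xs ↭ x ∷ xs
putAt-↭ k x xs =
  ↭-trans (shift x (take k xs) (drop k xs)) (↭-reflexive (cong (x ∷_) (take++drop≡id k xs)))

⊆-putAt : ∀ {A : Set} k (x : A) xs → xs ⊆ putAt k x xs
⊆-putAt k x xs =
  subst (_⊆ putAt k x xs) (take++drop≡id k xs) (Sublist.++⁺ ⊆-refl (x ∷ʳ ⊆-refl))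

putAt-nonempty : ∀ {A : Set} k (x : A) xs → putAt k x xs ≢ []
putAt-nonempty k x xs e with ++-conicalʳ (take k xs) _ e
... | ()

putAt-injective : ∀ {A : Set} k (x : A) {xs ys} → putAt k x xs ≡ putAt k x ys → xs ≡ ys
putAt-injective zero    x                   e = ∷-injectiveʳ e
putAt-injective (suc k) x {[]}     {[]}     e = refl
putAt-injective (suc k) x {[]}     {_ ∷ ys} e = ⊥-elim (putAt-nonempty k x ys (sym (∷-injectiveʳ e)))
putAt-injective (suc k) x {_ ∷ xs} {[]}     e = ⊥-elim (putAt-nonempty k x xs (∷-injectiveʳ e))
putAt-injective (suc k) x {_ ∷ _}  {_ ∷ _}  e =
  cong₂ _∷_ (∷-injectiveˡ e) (putAt-injective k x (∷-injectiveʳ e))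

ρ-injective : ∀ i j {xs ys} → ρ i j xs ≡ ρ i j ys → xs ≡ ys
ρ-injective i j e = map-injective (bump-injective i) (putAt-injective (j ∸ 1) i e)

ρ-unbump : ∀ i k {L} → All (_≢ i) L → ρ i (suc k) (map (unbump i) L) ≡ putAt k i L
ρ-unbump i k {L} L≢i =
  cong (putAt k i) (trans (sym (map-∘ L)) (map-id-local (All.map (bump-unbump i _) L≢i)))

apply-injective : ∀ o {xs ys} → apply o xs ≡ apply o ys → xs ≡ ys
apply-injective r11 = ρ-injective 1 1
apply-injective r12 = ρ-injective 1 2
apply-injective r21 = ρ-injective 2 1
apply-injective r22 = ρ-injective 2 2

apply-nonempty : ∀ o xs → apply o xs ≢ []
apply-nonempty r11 xs = putAt-nonempty 0 1 (map (bump 1) xs)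
apply-nonempty r12 xs = putAt-nonempty 1 1 (map (bump 1) xs)
apply-nonempty r21 xs = putAt-nonempty 0 2 (map (bump 2) xs)
apply-nonempty r22 xs = putAt-nonempty 1 2 (map (bump 2) xs)

monotone-<⇔ : ∀ {f : ℕ → ℕ} → f Preserves _<_ ⟶ _<_ → ∀ x y → (f x < f y) ⇔ (x < y)
monotone-<⇔ {f} mono x y = mk⇔ reflects mono
  where
  reflects : f x < f y → x < y
  reflects fx<fy with <-cmp x y
  ... | tri< x<y _ _  = x<y
  ... | tri≈ _ refl _ = ⊥-elim (<-irrefl refl fx<fy)
  ... | tri> _ _ y<x  = ⊥-elim (<-asym fx<fy (mono y<x))

monotone-by-steps : ∀ {f : ℕ → ℕ} → (∀ n → f n < f (suc n)) → f Preserves _<_ ⟶ _<_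
monotone-by-steps step {x} {suc y} x<1+y with m<1+n⇒m<n∨m≡n x<1+y
... | inj₁ x<y  = <-trans (monotone-by-steps step x<y) (step y)
... | inj₂ refl = step x

OrderIso-map : ∀ {f : ℕ → ℕ} → f Preserves _<_ ⟶ _<_ →
               ∀ {k} (σ : Vec ℕ k) → OrderIso (Vec.map f σ) σ
OrderIso-map {f} mono σ a b rewrite lookup-map a f σ | lookup-map b f σ =
  monotone-<⇔ mono (Vec.lookup σ a) (Vec.lookup σ b)

Contains-image : ∀ {f : ℕ → ℕ} {π k} → f Preserves _<_ ⟶ _<_ →
                 (p : Vec ℕ k) → toList (Vec.map f p) ⊆ π → Contains π p
Contains-image mono p sub = Vec.map _ p , sub , OrderIso-map mono p

Contains-map : ∀ {f : ℕ → ℕ} {π k} → f Preserves _<_ ⟶ _<_ →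
               (p : Vec ℕ k) → Contains π p → Contains (map f π) p
Contains-map {f} {π} mono p (σ , σ⊆π , σ≅p) =
  Vec.map f σ , subst (_⊆ map f π) (sym (toList-map f σ)) (Sublist.map⁺ f σ⊆π) ,
  λ a b → ⇔.trans (OrderIso-map mono σ a b) (σ≅p a b)

Contains-⊆ : ∀ {π π′ k} → π ⊆ π′ → (p : Vec ℕ k) → Contains π p → Contains π′ p
Contains-⊆ π⊆π′ p (σ , σ⊆π , σ≅p) = σ , ⊆-trans σ⊆π π⊆π′ , σ≅p

Contains-ρ : ∀ i j {π k} (p : Vec ℕ k) → Contains π p → Contains (ρ i j π) p
Contains-ρ i j {π} p c =
  Contains-⊆ (⊆-putAt (j ∸ 1) i (map (bump i) π)) p (Contains-map (bump-monotone i) p c)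

AlmostIncreasing1-ρ⁻ : ∀ i j {π} → AlmostIncreasing1 (ρ i j π) → AlmostIncreasing1 π
AlmostIncreasing1-ρ⁻ i j (¬4321 , ¬4312 , ¬3421 , ¬3412) =
  ¬4321 ∘ Contains-ρ i j p4321 , ¬4312 ∘ Contains-ρ i j p4312 ,
  ¬3421 ∘ Contains-ρ i j p3421 , ¬3412 ∘ Contains-ρ i j p3412

relabel : ℕ → ℕ → ℕ → ℕ
relabel a b 0 = 0
relabel a b 1 = 1
relabel a b 2 = 2
relabel a b 3 = a
relabel a b (suc (suc (suc (suc k)))) = k + b

relabel-monotone : ∀ {a b} → 2 < a → a < b → relabel a b Preserves _<_ ⟶ _<_
relabel-monotone {a} {b} 2<a a<b = monotone-by-steps step
  where
  step : ∀ n → relabel a b n < relabel a b (suc n)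
  step 0 = s≤s z≤n
  step 1 = s≤s (s≤s z≤n)
  step 2 = 2<a
  step 3 = a<b
  step (suc (suc (suc (suc k)))) = n<1+n (k + b)

∈∈⇒⊆ : ∀ {A : Set} {x y : A} {xs} → x ∈ xs → y ∈ xs → x ≢ y →
        (x ∷ y ∷ []) ⊆ xs ⊎ (y ∷ x ∷ []) ⊆ xs
∈∈⇒⊆ (here refl) (here refl) x≢y = ⊥-elim (x≢y refl)
∈∈⇒⊆ (here refl) (there y∈)  _   = inj₁ (refl ∷ from∈ y∈)
∈∈⇒⊆ (there x∈)  (here refl) _   = inj₂ (refl ∷ from∈ x∈)
∈∈⇒⊆ (there x∈)  (there y∈)  x≢y = Sum.map (_ ∷ʳ_) (_ ∷ʳ_) (∈∈⇒⊆ x∈ y∈ x≢y)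

forbidden : ∀ {a b rest} → 2 < a → 2 < b → a ≢ b →
            (1 ∷ 2 ∷ []) ⊆ rest ⊎ (2 ∷ 1 ∷ []) ⊆ rest → ¬ AlmostIncreasing1 (a ∷ b ∷ rest)
forbidden {a} {b} 2<a 2<b a≢b order (¬4321 , ¬4312 , ¬3421 , ¬3412) with <-cmp a b | order
... | tri≈ _ a≡b _ | _       = a≢b a≡b
... | tri< a<b _ _ | inj₁ 12⊆ = ¬3412 (Contains-image (relabel-monotone 2<a a<b) p3412 (refl ∷ refl ∷ 12⊆))
... | tri< a<b _ _ | inj₂ 21⊆ = ¬3421 (Contains-image (relabel-monotone 2<a a<b) p3421 (refl ∷ refl ∷ 21⊆))
... | tri> _ _ b<a | inj₁ 12⊆ = ¬4312 (Contains-image (relabel-monotone 2<b b<a) p4312 (refl ∷ refl ∷ 12⊆))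
... | tri> _ _ b<a | inj₂ 21⊆ = ¬4321 (Contains-image (relabel-monotone 2<b b<a) p4321 (refl ∷ refl ∷ 21⊆))

positive-≢1-≢2⇒>2 : ∀ {x} → 0 < x → x ≢ 1 → x ≢ 2 → 2 < x
positive-≢1-≢2⇒>2 {1}                 _ x≢1 _   = ⊥-elim (x≢1 refl)
positive-≢1-≢2⇒>2 {2}                 _ _   x≢2 = ⊥-elim (x≢2 refl)
positive-≢1-≢2⇒>2 {suc (suc (suc _))} _ _   _   = s≤s (s≤s (s≤s z≤n))

one-or-two-leads : ∀ {m a b rest} → IsPerm (suc (suc m)) (a ∷ b ∷ rest) →
                   AlmostIncreasing1 (a ∷ b ∷ rest) → a ≢ 1 → b ≢ 1 → a ≢ 2 → b ≢ 2 → ⊥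
one-or-two-leads {m} {a} {b} {rest} perm avoids a≢1 b≢1 a≢2 b≢2 =
  forbidden (positive-≢1-≢2⇒>2 (positive (here refl)) a≢1 a≢2)
            (positive-≢1-≢2⇒>2 (positive (there (here refl))) b≢1 b≢2) a≢b
            (∈∈⇒⊆ (inRest (here refl) a≢1 b≢1) (inRest (there (here refl)) a≢2 b≢2) (λ ())) avoids
  where
  positive : ∀ {x} → x ∈ a ∷ b ∷ rest → 0 < x
  positive x∈ = ∈-oneTo⇒positive (∈-resp-↭ perm x∈)

  inRest : ∀ {x} → x ∈ oneTo (suc (suc m)) → a ≢ x → b ≢ x → x ∈ rest
  inRest x∈ a≢x b≢x with ∈-resp-↭ (↭-sym perm) x∈
  ... | here refl            = ⊥-elim (a≢x refl)
  ... | there (here refl)    = ⊥-elim (b≢x refl)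
  ... | there (there x∈rest) = x∈rest

  a≢b : a ≢ b
  a≢b a≡b = Unique.Unique[x∷xs]⇒x∉xs
    (Permutationₛ.Unique-resp-↭ (setoid ℕ) (↭⇒↭ₛ (↭-sym perm)) (Unique-oneTo (suc (suc m))))
    (here a≡b)

leadingOp : List ℕ → Op
leadingOp (1 ∷ _)     = r11
leadingOp (_ ∷ 1 ∷ _) = r12
leadingOp (2 ∷ _)     = r21
leadingOp _           = r22

data InsertsTwo : Op → Set where
  ρ₂₁ : InsertsTwo r21
  ρ₂₂ : InsertsTwo r22

leadingOp-apply : ∀ o h t → (InsertsTwo o → h ≢ 1) → leadingOp (apply o (h ∷ t)) ≡ o
leadingOp-apply r11 h             t _   = refl
leadingOp-apply r12 zero          t _   = refl
leadingOp-apply r12 (suc h)       t _   = refl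
leadingOp-apply r21 zero          t _   = refl
leadingOp-apply r21 (suc zero)    t h≢1 = ⊥-elim (h≢1 ρ₂₁ refl)
leadingOp-apply r21 (suc (suc h)) t _   = refl
leadingOp-apply r22 zero          t _   = refl
leadingOp-apply r22 (suc zero)    t h≢1 = ⊥-elim (h≢1 ρ₂₂ refl)
leadingOp-apply r22 (suc (suc h)) t _   = refl

leadingOp-compose : ∀ o w → last (o ∷ w) ≡ just r11 → NoBadPair (o ∷ w) →
                    leadingOp (compose (o ∷ w)) ≡ o
leadingOp-compose o []       refl _ = refl
leadingOp-compose o (o′ ∷ w) ends (nb-cons _ _ _ ¬21 ¬22 nb)
  with compose (o′ ∷ w) in eq | leadingOp-compose o′ w ends nb
... | []    | _  = ⊥-elim (apply-nonempty o′ (compose w) eq)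
... | h ∷ t | ih = leadingOp-apply o h t λ where
  ρ₂₁ refl → ¬21 (refl , sym ih)
  ρ₂₂ refl → ¬22 (refl , sym ih)

NoBadPair-tail : ∀ {o w} → NoBadPair (o ∷ w) → NoBadPair w
NoBadPair-tail (nb-one _)             = nb-nil
NoBadPair-tail (nb-cons _ _ _ _ _ nb) = nb

Admissible-tail : ∀ {n o o′ w} → Admissible n (o ∷ o′ ∷ w) → Admissible (pred n) (o′ ∷ w)
Admissible-tail (refl , ends , nb) = refl , ends , NoBadPair-tail nb

compose-injective : ∀ {n} w w′ → Admissible n w → Admissible n w′ → compose w ≡ compose w′ → w ≡ w′
compose-injective []          _           (_ , () , _)   _              _
compose-injective (_ ∷ _)     []          _              (_ , () , _)   _
compose-injective (_ ∷ [])    (_ ∷ [])    (_ , refl , _) (_ , refl , _) _ = refl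
compose-injective (_ ∷ [])    (_ ∷ _ ∷ _) (refl , _)     (() , _)       _
compose-injective (_ ∷ _ ∷ _) (_ ∷ [])    (refl , _)     (() , _)       _
compose-injective (o ∷ v@(_ ∷ _)) (o′ ∷ v′@(_ ∷ _)) adm@(_ , ends , nb) adm′@(_ , ends′ , nb′) e =
  cong₂ _∷_ o≡o′ (compose-injective v v′ (Admissible-tail adm) (Admissible-tail adm′) (tails o≡o′ e))
  where
  o≡o′ : o ≡ o′
  o≡o′ = trans (sym (leadingOp-compose o v ends nb))
               (trans (cong leadingOp e) (leadingOp-compose o′ v′ ends′ nb′))
  tails : o ≡ o′ → apply o (compose v) ≡ apply o′ (compose v′) → compose v ≡ compose v′
  tails refl = apply-injective o

Decomposition : ℕ → List ℕ → Set
Decomposition n π = Σ (List Op) λ w → Admissible n w × compose w ≡ π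

NoBadPair-∷ : ∀ {o o′ w} → (InsertsTwo o → o′ ≢ r11) → NoBadPair (o′ ∷ w) → NoBadPair (o ∷ o′ ∷ w)
NoBadPair-∷ {r11} _  = nb-cons _ _ _ (λ { (() , _) }) (λ { (() , _) })
NoBadPair-∷ {r12} _  = nb-cons _ _ _ (λ { (() , _) }) (λ { (() , _) })
NoBadPair-∷ {r21} ok = nb-cons _ _ _ (λ (_ , o′≡r11) → ok ρ₂₁ o′≡r11) (λ { (() , _) })
NoBadPair-∷ {r22} ok = nb-cons _ _ _ (λ { (() , _) }) (λ (_ , o′≡r11) → ok ρ₂₂ o′≡r11)

prepend : ∀ {n π} o → Decomposition n π → (InsertsTwo o → ∀ {t} → π ≢ 1 ∷ t) →
          Decomposition (suc n) (apply o π)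
prepend o ([] , (_ , () , _) , _) _
prepend o (o′ ∷ w , (len , ends , nb) , refl) fits =
  o ∷ o′ ∷ w , (cong suc len , ends , NoBadPair-∷ (λ { two refl → fits two refl }) nb) , refl

decompose-step : ∀ {m i} o k L → apply o ≗ ρ i (suc k) → 1 ≤ i → i ≤ suc (suc m) →
                 (InsertsTwo o → ∀ {t} → map (unbump i) L ≢ 1 ∷ t) →
                 (∀ π → IsPerm (suc m) π → AlmostIncreasing1 π → Decomposition (suc m) π) →
                 IsPerm (suc (suc m)) (putAt k i L) → AlmostIncreasing1 (putAt k i L) →
                 Decomposition (suc (suc m)) (putAt k i L)
decompose-step {m} {i} o k L apply≗ρ 1≤i i≤2+m fits decompose perm avoids =
  subst (Decomposition _) (trans (apply≗ρ π′) π≡) (prepend o (decompose π′ perm′ avoids′) fits)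
  where
  π′ : List ℕ
  π′ = map (unbump i) L
  L↭ : L ↭ map (bump i) (oneTo (suc m))
  L↭ = drop-∷ (↭-trans (↭-sym (putAt-↭ k i L)) (↭-trans perm (oneTo-↭-bump (suc m) 1≤i i≤2+m)))
  π≡ : ρ i (suc k) π′ ≡ putAt k i L
  π≡ = ρ-unbump i k (↭-map-bump⇒≢ i (oneTo (suc m)) L↭)
  perm′ : IsPerm (suc m) π′
  perm′ = unbump-↭ i L↭
  avoids′ : AlmostIncreasing1 π′
  avoids′ = AlmostIncreasing1-ρ⁻ i (suc k) (subst AlmostIncreasing1 (sym π≡) avoids)

decompose : ∀ m π → IsPerm (suc m) π → AlmostIncreasing1 π → Decomposition (suc m) π
decompose zero π perm _ with ↭-singleton-inv perm
... | refl = r11 ∷ [] , (refl , refl , nb-one r11) , refl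
decompose (suc m) []       perm _ with ↭-length perm
... | ()
decompose (suc m) (_ ∷ []) perm _ with ↭-length perm
... | ()
decompose (suc m) (a ∷ b ∷ rest) perm avoids with a ≟ 1 | b ≟ 1 | a ≟ 2 | b ≟ 2
... | yes refl | _        | _        | _ =
  decompose-step r11 0 (b ∷ rest) (λ _ → refl) (s≤s z≤n) (s≤s z≤n) (λ ()) (decompose m) perm avoids
... | no _     | yes refl | _        | _ =
  decompose-step r12 1 (a ∷ rest) (λ _ → refl) (s≤s z≤n) (s≤s z≤n) (λ ()) (decompose m) perm avoids
... | no _     | no b≢1   | yes refl | _ =
  decompose-step r21 0 (b ∷ rest) (λ _ → refl) (s≤s z≤n) (s≤s (s≤s z≤n))
    (λ _ e → b≢1 (unbump-fixes-< 2 b (∷-injectiveˡ e) (s≤s (s≤s z≤n)))) (decompose m) perm avoids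
... | no a≢1   | no _     | no _     | yes refl =
  decompose-step r22 1 (a ∷ rest) (λ _ → refl) (s≤s z≤n) (s≤s (s≤s z≤n))
    (λ _ e → a≢1 (unbump-fixes-< 2 a (∷-injectiveˡ e) (s≤s (s≤s z≤n)))) (decompose m) perm avoids
... | no a≢1   | no b≢1   | no a≢2   | no b≢2 =
  ⊥-elim (one-or-two-leads perm avoids a≢1 b≢1 a≢2 b≢2)

mainTheorem14 : (n : ℕ) → 1 ≤ n → (π : List ℕ) → IsPerm n π → AlmostIncreasing1 π →
    ∃! _≡_ (λ (os : List Op) → Admissible n os × compose os ≡ π)
mainTheorem14 (suc m) _ π perm avoids with decompose m π perm avoids
... | w , adm , refl = w , (adm , refl) , λ (adm′ , e) → compose-injective w _ adm adm′ (sym e)
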